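{- Let an instance of $P|G=\textit{block graph},p_j=1|C_{\max}$ with $n\ge 1$ unit-time jobs and $m\ge 2$ identical machines be given, in which every block of $G$ has at most $m$ vertices, and write $n=d(m-1)+r$ with $d\ge 0$ and $r\in\{0,\dots,m-2\}$. The greedy algorithm described in the context returns a schedule in which every machine is assigned at most $\lceil n/(m-1)\rceil$ jobs. Moreover, if $r=0$ then the constructed schedule has at least one machine with load strictly less than $\lceil n/(m-1)\rceil$; otherwise it has at least $m-r$ such machines.
   Context: A block graph is a graph in which every maximal 2-connected subgraph (block) is a clique; cut-vertices are vertices in more than one block; the block-cut forest $T_G$ has as nodes the blocks and the cut-vertices, a block adjacent to each cut-vertex it contains, each component rooted. A schedule assigns jobs to machines so that adjacent jobs are on different machines; the load of a machine is its number of jobs. The greedy algorithm: process the blocks in the order of a pre-order traversal of all components of $T_G$. For the current block $B$: list the jobs of $B$ as $L_J$; take the $|B|$ machines with smallest current loads (ties arbitrary), ordered by non-decreasing load, as $L_M$. If $B$ has a parent cut-vertex $u$ in $T_G$ already assigned to machine $M'$: if $M'\in L_M$ remove $M'$ from $L_M$, otherwise remove the last machine of $L_M$; and remove $u$ from $L_J$. Then assign the $i$-th job of $L_J$ to the $i$-th machine of $L_M$ for $i=1,\dots,|L_M|$. -}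

module Defs where

open import Data.Nat using (ℕ; zero; suc; _+_; _*_; _∸_; _≤_; _<_; _<?_)
open import Data.Nat.DivMod using (_/_)
open import Data.Fin using (Fin)
open import Data.Fin.Properties using () renaming (_≟_ to _≟F_)
open import Data.Fin.Subset using (Subset; _∈_; _∉_; _⊆_; _-_; Nonempty)
open import Data.Vec using (Vec; lookup; _[_]≔_)
open import Data.List using (List; []; _∷_; _++_; filter; length; take; zip; allFin)
open import Data.List.Relation.Unary.All using (All)
open import Data.List.Relation.Unary.AllPairs using (AllPairs)
open import Data.List.Relation.Unary.Unique.Propositional using (Unique)
open import Data.List.Membership.Propositional using () renaming (_∈_ to _∈ₗ_; _∉_ to _∉ₗ_)
open import Data.List.Membership.DecPropositional using () renaming (_∈?_ to ∈?-dec)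
open import Data.Maybe using (Maybe; just; nothing)
open import Data.Maybe.Properties using (≡-dec)
open import Data.Product using (Σ; ∃; _×_; _,_; proj₁; proj₂)
open import Data.Sum using (_⊎_)
open import Relation.Binary.PropositionalEquality using (_≡_)
open import Relation.Nullary using (¬_; ¬?; Dec; yes; no)
open import Function.Bundles using (_⇔_)

-- Simple graphs on the vertex set Fin n (vertices = jobs)

record Graph (n : ℕ) : Set₁ where
  field
    _~_   : Fin n → Fin n → Set
    sym   : ∀ {u v} → u ~ v → v ~ u
    irrefl : ∀ {u} → ¬ (u ~ u)
open Graph public

module _ {n : ℕ} (G : Graph n) where
  private _∼_ = _~_ G

  data Reach (S : Subset n) (u : Fin n) : Fin n → Set where
    here : u ∈ S → Reach S u u
    step : ∀ {w v} → Reach S u w → w ∼ v → v ∈ S → Reach S u v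

  Connected : Subset n → Set
  Connected S = ∀ u v → u ∈ S → v ∈ S → Reach S u v

  -- S induces a connected subgraph without cut-vertex (2-connected in the
  -- sense of blocks: this includes K1 and K2)
  Nonseparable : Subset n → Set
  Nonseparable S = Nonempty S × Connected S × (∀ v → v ∈ S → Connected (S - v))

  IsBlock : Subset n → Set
  IsBlock S = Nonseparable S × (∀ T → S ⊆ T → Nonseparable T → T ≡ S)

  IsClique : Subset n → Set
  IsClique S = ∀ u v → u ∈ S → v ∈ S → ¬ (u ≡ v) → u ∼ v

  IsBlockGraph : Set
  IsBlockGraph = ∀ S → IsBlock S → IsClique S

  IsCutVertex : Fin n → Set
  IsCutVertex v = Σ (Subset n) λ B₁ → Σ (Subset n) λ B₂ →
    IsBlock B₁ × IsBlock B₂ × ¬ (B₁ ≡ B₂) × v ∈ B₁ × v ∈ B₂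

data Node (n : ℕ) : Set where
  blkN : Subset n → Node n
  cutN : Fin n → Node n

data Tree (A : Set) : Set where
  node : A → List (Tree A) → Tree A

Forest : Set → Set
Forest A = List (Tree A)

label : ∀ {A} → Tree A → A
label (node a _) = a

mutual
  preorder : ∀ {A} → Tree A → List A
  preorder (node a ts) = a ∷ preorderF ts

  preorderF : ∀ {A} → Forest A → List A
  preorderF [] = []
  preorderF (t ∷ ts) = preorder t ++ preorderF ts

mutual
  edges : ∀ {A} → Tree A → List (A × A)
  edges (node a ts) = childEdges a ts ++ edgesF ts

  childEdges : ∀ {A} → A → Forest A → List (A × A)
  childEdges a [] = []
  childEdges a (t ∷ ts) = (a , label t) ∷ childEdges a ts

  edgesF : ∀ {A} → Forest A → List (A × A)
  edgesF [] = []
  edgesF (t ∷ ts) = edges t ++ edgesF ts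

data Incident {n : ℕ} : Node n → Node n → Set where
  bc : ∀ {B v} → v ∈ B → Incident (blkN B) (cutN v)
  cb : ∀ {B v} → v ∈ B → Incident (cutN v) (blkN B)

-- F is the block-cut forest T_G of G, with each component rooted
-- (at an arbitrary node) and children in an arbitrary order.
record IsBlockCutForest {n : ℕ} (G : Graph n) (F : Forest (Node n)) : Set where
  field
    nodesUnique : Unique (preorderF F)
    blockNodes  : ∀ B → (blkN B ∈ₗ preorderF F) ⇔ IsBlock G B
    cutNodes    : ∀ v → (cutN v ∈ₗ preorderF F) ⇔ IsCutVertex G v
    edgesSound  : ∀ a b → (a , b) ∈ₗ edgesF F → Incident a b
    edgesComplete : ∀ B v → IsBlock G B → IsCutVertex G v → v ∈ B →
      ((blkN B , cutN v) ∈ₗ edgesF F) ⊎ ((cutN v , blkN B) ∈ₗ edgesF F)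

-- the blocks in pre-order, each with its parent cut-vertex (if its parent
-- in T_G is a cut-vertex)
mutual
  blockSeq : ∀ {n} → Maybe (Fin n) → Tree (Node n) → List (Subset n × Maybe (Fin n))
  blockSeq p (node (blkN B) ts) = (B , p) ∷ blockSeqF nothing ts
  blockSeq p (node (cutN v) ts) = blockSeqF (just v) ts

  blockSeqF : ∀ {n} → Maybe (Fin n) → Forest (Node n) → List (Subset n × Maybe (Fin n))
  blockSeqF p [] = []
  blockSeqF p (t ∷ ts) = blockSeq p t ++ blockSeqF p ts

-- (Partial) schedules: job j ↦ machine (or not yet assigned)

Assign : ℕ → ℕ → Set
Assign n m = Vec (Maybe (Fin m)) n

load : ∀ {n m} → Assign n m → Fin m → ℕ
load {n} σ k = length (filter (λ j → ≡-dec _≟F_ (lookup σ j) (just k)) (allFin n))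

assignPairs : ∀ {n m} → List (Fin n × Fin m) → Assign n m → Assign n m
assignPairs [] σ = σ
assignPairs ((j , k) ∷ ps) σ = assignPairs ps (σ [ j ]≔ just k)

_∈F?_ : ∀ {m} (k : Fin m) (xs : List (Fin m)) → Dec (k ∈ₗ xs)
_∈F?_ = ∈?-dec _≟F_

-- removal of the parent cut-vertex u (if already assigned to M')
adjust : ∀ {n m} → Assign n m → Maybe (Fin n) → List (Fin n) → List (Fin m)
       → List (Fin n) × List (Fin m)
adjust σ nothing LJ LM = LJ , LM
adjust σ (just u) LJ LM with lookup σ u
... | nothing = LJ , LM
... | just M' with _∈F?_ M' LM
...   | yes _ = filter (λ j → ¬? (j ≟F u)) LJ , filter (λ k → ¬? (k ≟F M')) LM
...   | no  _ = filter (λ j → ¬? (j ≟F u)) LJ , take (length LM ∸ 1) LM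

record Step {n m : ℕ} (σ : Assign n m) (B : Subset n) (p : Maybe (Fin n))
            (σ' : Assign n m) : Set where
  field
    LJ : List (Fin n)
    LM : List (Fin m)
    LJ-unique : Unique LJ
    LJ-jobs   : ∀ j → (j ∈ₗ LJ) ⇔ (j ∈ B)
    LM-unique : Unique LM
    LM-size   : length LM ≡ Data.Fin.Subset.∣ B ∣
    LM-sorted : AllPairs (λ a b → load σ a ≤ load σ b) LM
    LM-smallest : ∀ k → k ∉ₗ LM → All (λ a → load σ a ≤ load σ k) LM
    result : σ' ≡ assignPairs (zip (proj₁ (adjust σ p LJ LM))
                                   (proj₂ (adjust σ p LJ LM))) σ

data Run {n m : ℕ} : Assign n m → List (Subset n × Maybe (Fin n)) → Assign n m → Set where
  done : ∀ {σ} → Run σ [] σ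
  step : ∀ {σ σ₁ σ₂ B p rest} → Step σ B p σ₁ → Run σ₁ rest σ₂ → Run σ ((B , p) ∷ rest) σ₂

emptyAssign : ∀ {n m} → Assign n m
emptyAssign = Data.Vec.replicate _ nothing

-- σ is a possible output of the greedy algorithm on G (for the block-cut
-- forest F, any tie-breaking)
GreedyOutput : ∀ {n m} → Graph n → Forest (Node n) → Assign n m → Set
GreedyOutput G F σ = Run emptyAssign (blockSeqF nothing F) σ

ceilDiv : ℕ → ℕ → ℕ
ceilDiv a zero = zero
ceilDiv a (suc k) = (a + k) / suc k

countBelow : ∀ {n m} → Assign n m → ℕ → ℕ
countBelow {m = m} σ c = length (filter (λ k → load σ k <? c) (allFin m))

-- Write m + 1 for the number of machines and a_y for the number of machines whose load
-- exceeds y. The greedy run keeps the invariant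
--   a_y > 0  ⇒  y·m + a_y ≤ number of scheduled jobs                            (Balanced)
-- Processing the block-cut forest in pre-order makes the parent cut-vertex the only job of a
-- block that is already scheduled, so every machine chosen for a block except at most one (the
-- one dropped for that parent) receives a new job. Hence when some machine first rises above
-- the maximal level y, all machines but one are at level y or rise with it, which pays for the
-- extra m. Writing n = q·m + s with 1 ≤ s ≤ m, the invariant at level q + 1 = ⌈n/m⌉ bounds
-- every load, and at level q it leaves at most s machines of load q + 1.
module Submission where

open import Defs hiding (sym)
open import Data.Bool using (true; false; if_then_else_)
open import Data.Empty using (⊥; ⊥-elim)
open import Data.Fin using (Fin; zero; suc; punchIn)
open import Data.Fin.Properties using (punchInᵢ≢i)
  renaming (_≟_ to _≟F_; suc-injective to Fin-suc-injective)
open import Data.Fin.Subset using (Subset; ∣_∣) renaming (_∈_ to _∈ₛ_)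
open import Data.Fin.Subset.Properties using () renaming (_∈?_ to _∈ₛ?_)
open import Data.List using (List; []; _∷_; _++_; length; filter; tabulate; zip; take)
open import Data.List.Properties using (filter-all; filter-notAll; length-take)
open import Data.List.Membership.Propositional using (_∈_; _∉_)
open import Data.List.Membership.Propositional.Properties
  using (∈-filter⁻; ∈-++⁺ˡ; ∈-++⁺ʳ; ∈-++⁻)
open import Data.List.Relation.Binary.Sublist.Heterogeneous as Sublist
  using (Sublist; []; _∷_; _∷ʳ_)
import Data.List.Relation.Binary.Sublist.Heterogeneous.Properties as Sublist
open import Data.List.Relation.Binary.Sublist.Propositional.Properties using (take-⊆; Any-resp-⊆)
open import Data.List.Relation.Unary.All as All using (All; []; _∷_)
open import Data.List.Relation.Unary.All.Properties using (All¬⇒¬Any; ++⁻ˡ; ++⁻ʳ)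
open import Data.List.Relation.Unary.Any as Any using (Any; here; there)
open import Data.List.Relation.Unary.AllPairs as AllPairs using (AllPairs; []; _∷_)
open import Data.List.Relation.Unary.Unique.Propositional using (Unique)
import Data.List.Relation.Unary.Unique.Propositional.Properties as Unique
open import Data.Maybe using (Maybe; just; nothing)
open import Data.Maybe.Properties using (≡-dec; just-injective)
open import Data.Nat
  using (NonZero; ℕ; zero; suc; _+_; _*_; _∸_; _≤_; _<_; z≤n; s≤s; z<s; _<?_; _≟_)
open import Data.Nat.Properties
open import Algebra.Properties.CommutativeMonoid.Sum +-0-commutativeMonoid
  using (sum; sum-cong-≗; ∑-distrib-+; ∑-comm; sum-remove)
open import Data.Nat.DivMod using (_/_; +-distrib-/-∣ˡ; m*n/n≡m; m<n⇒m/n≡0)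
open import Data.Nat.Divisibility using (n∣m*n)
open import Data.Nat.Tactic.RingSolver using (solve-∀)
open import Data.Product as Product using (∃; _×_; _,_; proj₁; proj₂)
open import Data.Sum as Sum using (_⊎_; inj₁; inj₂)
open import Data.Vec using ([]; _∷_; lookup; _[_]≔_)
open import Data.Vec.Properties using (lookup∘update; lookup∘update′; lookup-replicate)
open import Function using (_∘_; id; _⇔_; Equivalence)
open import Level using (Level; _⊔_)
open import Relation.Binary using (tri<; tri≈; tri>; DecidableEquality)
open import Relation.Binary.PropositionalEquality
  using (_≡_; _≢_; _≗_; refl; sym; trans; cong; cong₂; subst; subst₂; module ≡-Reasoning)
open import Relation.Nullary using (¬_; ¬?; Dec; yes; no; does; contradiction; _×-dec_)
open import Relation.Unary using (Pred; Decidable; _⊆_)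
open import Relation.Unary.Properties using (_∩?_; ∁?)

private variable
  a ℓ ℓ′ : Level
  A B : Set a
  n m : ℕ

-- Counting over Fin

𝟙 : Dec A → ℕ
𝟙 a? = if does a? then 1 else 0

𝟙-yes : (a? : Dec A) → A → 𝟙 a? ≡ 1
𝟙-yes (yes _) _ = refl
𝟙-yes (no ¬a) a = contradiction a ¬a

𝟙-no : (a? : Dec A) → ¬ A → 𝟙 a? ≡ 0
𝟙-no (yes a) ¬a = contradiction a ¬a
𝟙-no (no _) _ = refl

𝟙-cong : (a? : Dec A) (b? : Dec B) → (A → B) → (B → A) → 𝟙 a? ≡ 𝟙 b?
𝟙-cong a? (yes b) _ g = 𝟙-yes a? (g b)
𝟙-cong a? (no ¬b) f _ = 𝟙-no a? (¬b ∘ f)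

𝟙-mono : (a? : Dec A) (b? : Dec B) → (A → B) → 𝟙 a? ≤ 𝟙 b?
𝟙-mono (yes a) (yes _) _ = ≤-refl
𝟙-mono (yes a) (no ¬b) f = contradiction (f a) ¬b
𝟙-mono (no _) _ _ = z≤n

sum≤n : (f : Fin n → ℕ) → (∀ i → f i ≤ 1) → sum f ≤ n
sum≤n {zero} f _ = z≤n
sum≤n {suc n} f f≤1 = +-mono-≤ (f≤1 zero) (sum≤n (f ∘ suc) (f≤1 ∘ suc))

sum-differ-at : (f g : Fin n → ℕ) (i : Fin n) → (∀ k → k ≢ i → f k ≡ g k) →
  sum f + g i ≡ sum g + f i
sum-differ-at {suc n} f g i f≡g = begin
  sum f + g i                        ≡⟨ cong (_+ g i) (sum-remove f) ⟩
  (f i + sum (f ∘ punchIn i)) + g i  ≡⟨ cong (λ r → (f i + r) + g i) (sum-cong-≗ off-i) ⟩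
  (f i + sum (g ∘ punchIn i)) + g i  ≡⟨ +-comm (f i + _) (g i) ⟩
  g i + (f i + sum (g ∘ punchIn i))  ≡⟨ cong (g i +_) (+-comm (f i) _) ⟩
  g i + (sum (g ∘ punchIn i) + f i)  ≡⟨ +-assoc (g i) _ (f i) ⟨
  (g i + sum (g ∘ punchIn i)) + f i  ≡⟨ cong (_+ f i) (sum-remove g) ⟨
  sum g + f i                        ∎
  where
  open ≡-Reasoning
  off-i : f ∘ punchIn i ≗ g ∘ punchIn i
  off-i k = f≡g (punchIn i k) (punchInᵢ≢i i k)

count : {P : Pred (Fin n) ℓ} → Decidable P → ℕ
count P? = sum (λ k → 𝟙 (P? k))

module _ {P : Pred (Fin n) ℓ} (P? : Decidable P) where

  count-cong : {Q : Pred (Fin n) ℓ′} (Q? : Decidable Q) → P ⊆ Q → Q ⊆ P → count P? ≡ count Q?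
  count-cong Q? P⊆Q Q⊆P = sum-cong-≗ λ k → 𝟙-cong (P? k) (Q? k) P⊆Q Q⊆P

  count-mono : {Q : Pred (Fin n) ℓ′} (Q? : Decidable Q) → P ⊆ Q → count P? ≤ count Q?
  count-mono Q? P⊆Q = sum-mono λ k → 𝟙-mono (P? k) (Q? k) P⊆Q
    where
    sum-mono : ∀ {n} {f g : Fin n → ℕ} → (∀ k → f k ≤ g k) → sum f ≤ sum g
    sum-mono {zero} _ = z≤n
    sum-mono {suc n} f≤g = +-mono-≤ (f≤g zero) (sum-mono (f≤g ∘ suc))

  count-split : {Q : Pred (Fin n) ℓ′} (Q? : Decidable Q) →
    count P? ≡ count (P? ∩? Q?) + count (P? ∩? ∁? Q?)
  count-split Q? = trans (sum-cong-≗ λ k → 𝟙-split (P? k) (Q? k)) (∑-distrib-+ {n} _ _)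
    where
    𝟙-split : (a? : Dec A) (b? : Dec B) → 𝟙 a? ≡ 𝟙 (a? ×-dec b?) + 𝟙 (a? ×-dec ¬? b?)
    𝟙-split (yes _) (yes _) = refl
    𝟙-split (yes _) (no _) = refl
    𝟙-split (no _) _ = refl

  count-complement : count P? + count (∁? P?) ≡ n
  count-complement = begin
    count P? + count (∁? P?)              ≡⟨ ∑-distrib-+ {n} _ _ ⟨
    sum (λ k → 𝟙 (P? k) + 𝟙 (¬? (P? k)))  ≡⟨ sum-cong-≗ (λ k → 𝟙-excluded-middle (P? k)) ⟩
    sum {n} (λ _ → 1)                     ≡⟨ sum-ones n ⟩
    n                                     ∎
    where
    open ≡-Reasoning
    𝟙-excluded-middle : (a? : Dec A) → 𝟙 a? + 𝟙 (¬? a?) ≡ 1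
    𝟙-excluded-middle (yes _) = refl
    𝟙-excluded-middle (no _) = refl
    sum-ones : ∀ n → sum {n} (λ _ → 1) ≡ n
    sum-ones zero = refl
    sum-ones (suc n) = cong suc (sum-ones n)

count-pos : {P : Pred (Fin n) ℓ} (P? : Decidable P) {k : Fin n} → P k → 0 < count P?
count-pos P? {zero} p = ≤-trans (≤-reflexive (sym (𝟙-yes (P? zero) p))) (m≤m+n _ _)
count-pos P? {suc k} p = ≤-trans (count-pos (P? ∘ suc) p) (m≤n+m _ _)

count-pos⁻ : {P : Pred (Fin n) ℓ} (P? : Decidable P) → 0 < count P? → ∃ P
count-pos⁻ {suc n} {P = P} P? = first (P? zero)
  where
  first : (p? : Dec (P zero)) → 0 < 𝟙 p? + count (P? ∘ suc) → ∃ P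
  first (yes p) _ = zero , p
  first (no _) pos = Product.map suc id (count-pos⁻ (P? ∘ suc) pos)

count-none : {P : Pred (Fin n) ℓ} (P? : Decidable P) → (∀ k → ¬ P k) → count P? ≡ 0
count-none P? none = n≤0⇒n≡0 (≮⇒≥ λ pos → none _ (proj₂ (count-pos⁻ P? pos)))

count≤1 : {P : Pred (Fin n) ℓ} (P? : Decidable P) →
  (∀ {i j} → P i → P j → i ≡ j) → count P? ≤ 1
count≤1 {zero} P? _ = z≤n
count≤1 {suc n} {P = P} P? unique = first (P? zero)
  where
  first : (p? : Dec (P zero)) → 𝟙 p? + count (P? ∘ suc) ≤ 1
  first (yes p) = ≤-reflexive (cong suc (count-none (P? ∘ suc) λ k pk → contradiction (unique p pk) λ ()))
  first (no _) = count≤1 (P? ∘ suc) λ pi pj → Fin-suc-injective (unique pi pj)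

count≤1+count-∩ : {S : Pred (Fin n) ℓ} {L : Pred (Fin n) ℓ′} {A : Pred (Fin n) a}
  (S? : Decidable S) (L? : Decidable L) (A? : Decidable A) →
  S ⊆ L → count L? ≤ suc (count S?) → A ⊆ L → count A? ≤ suc (count (S? ∩? A?))
count≤1+count-∩ S? L? A? S⊆L L≤1+S A⊆L = begin
  count A?                                ≡⟨ count-split A? S? ⟩
  count (A? ∩? S?) + count (A? ∩? ∁? S?)  ≤⟨ +-mono-≤ (≤-reflexive A∩S≡S∩A) A∖S≤L∖S ⟩
  count (S? ∩? A?) + count (L? ∩? ∁? S?)  ≤⟨ +-monoʳ-≤ _ L∖S≤1 ⟩
  count (S? ∩? A?) + 1                    ≡⟨ +-comm _ 1 ⟩
  suc (count (S? ∩? A?))                  ∎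
  where
  open ≤-Reasoning
  A∩S≡S∩A : count (A? ∩? S?) ≡ count (S? ∩? A?)
  A∩S≡S∩A = count-cong (A? ∩? S?) (S? ∩? A?) Product.swap Product.swap
  A∖S≤L∖S : count (A? ∩? ∁? S?) ≤ count (L? ∩? ∁? S?)
  A∖S≤L∖S = count-mono (A? ∩? ∁? S?) (L? ∩? ∁? S?) (Product.map₁ A⊆L)
  S≡L∩S : count S? ≡ count (L? ∩? S?)
  S≡L∩S = count-cong S? (L? ∩? S?) (λ s → S⊆L s , s) proj₂
  L∖S≤1 : count (L? ∩? ∁? S?) ≤ 1
  L∖S≤1 = +-cancelˡ-≤ (count S?) _ _ (begin
    count S? + count (L? ∩? ∁? S?)          ≡⟨ cong (_+ count (L? ∩? ∁? S?)) S≡L∩S ⟩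
    count (L? ∩? S?) + count (L? ∩? ∁? S?)  ≡⟨ count-split L? S? ⟨
    count L?                                ≤⟨ L≤1+S ⟩
    suc (count S?)                          ≡⟨ +-comm 1 _ ⟩
    count S? + 1                            ∎)

length-filter-tabulate : {P : Pred A ℓ} (P? : Decidable P) (f : Fin n → A) →
  length (filter P? (tabulate f)) ≡ count (P? ∘ f)
length-filter-tabulate {n = zero} P? f = refl
length-filter-tabulate {n = suc n} P? f with does (P? (f zero))
... | true = cong suc (length-filter-tabulate P? (f ∘ suc))
... | false = length-filter-tabulate P? (f ∘ suc)

𝟙-∈-∷ : ∀ {k ks} (k′ : Fin m) → k ∉ ks → 𝟙 (k′ ∈F? (k ∷ ks)) ≡ 𝟙 (k′ ≟F k) + 𝟙 (k′ ∈F? ks)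
𝟙-∈-∷ {k = k} {ks} k′ k∉ks = split (k′ ≟F k)
  where
  split : (e? : Dec (k′ ≡ k)) → 𝟙 (k′ ∈F? (k ∷ ks)) ≡ 𝟙 e? + 𝟙 (k′ ∈F? ks)
  split (yes refl) =
    trans (𝟙-yes (k′ ∈F? (k ∷ ks)) (here refl)) (cong suc (sym (𝟙-no (k′ ∈F? ks) k∉ks)))
  split (no k′≢k) = 𝟙-cong (k′ ∈F? (k ∷ ks)) (k′ ∈F? ks) drop-head there
    where
    drop-head : k′ ∈ k ∷ ks → k′ ∈ ks
    drop-head (here k′≡k) = contradiction k′≡k k′≢k
    drop-head (there k′∈ks) = k′∈ks

count-∈-unique : {ks : List (Fin m)} → Unique ks → count (_∈F? ks) ≡ length ks
count-∈-unique {m} {[]} [] = count-none {m} (_∈F? []) λ _ ()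
count-∈-unique {m} {k ∷ ks} (k∉ks ∷ unique) = begin
  count (_∈F? (k ∷ ks))                      ≡⟨ sum-cong-≗ (λ k′ → 𝟙-∈-∷ k′ (All¬⇒¬Any k∉ks)) ⟩
  sum (λ k′ → 𝟙 (k′ ≟F k) + 𝟙 (k′ ∈F? ks))  ≡⟨ ∑-distrib-+ {m} _ _ ⟩
  count (_≟F k) + count (_∈F? ks)            ≡⟨ cong₂ _+_ count-≟ (count-∈-unique unique) ⟩
  suc (length ks)                            ∎
  where
  open ≡-Reasoning
  count-≟ : count (_≟F k) ≡ 1
  count-≟ = ≤-antisym (count≤1 (_≟F k) λ i≡k j≡k → trans i≡k (sym j≡k)) (count-pos (_≟F k) refl)

∣∣≡count : (B : Subset n) → ∣ B ∣ ≡ count (_∈ₛ? B)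
∣∣≡count [] = refl
∣∣≡count (true ∷ B) = cong suc (∣∣≡count B)
∣∣≡count (false ∷ B) = ∣∣≡count B

length≡∣∣ : {js : List (Fin n)} {B : Subset n} → Unique js → (∀ j → (j ∈ js) ⇔ (j ∈ₛ B)) →
  length js ≡ ∣ B ∣
length≡∣∣ {js = js} {B} unique js⇔B = begin
  length js        ≡⟨ count-∈-unique unique ⟨
  count (_∈F? js)  ≡⟨ count-cong (_∈F? js) (_∈ₛ? B) (Equivalence.to (js⇔B _)) (Equivalence.from (js⇔B _)) ⟩
  count (_∈ₛ? B)   ≡⟨ ∣∣≡count B ⟨
  ∣ B ∣            ∎
  where open ≡-Reasoning

-- The load invariant

above : (Fin n → ℕ) → ℕ → ℕ
above l y = count (λ k → y <? l k)

Balanced : (Fin (suc m) → ℕ) → Set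
Balanced {m} l = ∀ y → 0 < above l y → y * m + above l y ≤ sum l

Balanced-resp-≗ : {l l′ : Fin (suc m) → ℕ} → l ≗ l′ → Balanced l → Balanced l′
Balanced-resp-≗ {m} {l} {l′} l≗l′ bal y pos =
  subst₂ (λ c s → y * m + c ≤ s) above≡ (sum-cong-≗ l≗l′) (bal y (subst (0 <_) (sym above≡) pos))
  where
  above≡ : above l y ≡ above l′ y
  above≡ = count-cong (λ k → y <? l k) (λ k → y <? l′ k)
             (λ {k} → subst (y <_) (l≗l′ k)) (λ {k} → subst (y <_) (sym (l≗l′ k)))

balanced-zero : {l : Fin (suc m) → ℕ} → (∀ k → l k ≡ 0) → Balanced l
balanced-zero {l = l} l≡0 y pos with count-pos⁻ (λ k → y <? l k) pos
... | k , y<lk = contradiction (subst (y <_) (l≡0 k) y<lk) λ ()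

above-+𝟙 : {S : Pred (Fin n) ℓ} (S? : Decidable S) (l : Fin n → ℕ) (y : ℕ) →
  above (λ k → l k + 𝟙 (S? k)) y ≡ above l y + count (λ k → S? k ×-dec (l k ≟ y))
above-+𝟙 {n} S? l y = trans (sum-cong-≗ λ k → 𝟙-step (l k) (S? k)) (∑-distrib-+ {n} _ _)
  where
  𝟙-step : (x : ℕ) (s? : Dec A) → 𝟙 (y <? x + 𝟙 s?) ≡ 𝟙 (y <? x) + 𝟙 (s? ×-dec (x ≟ y))
  𝟙-step x (no _) = trans
    (𝟙-cong (y <? x + 0) (y <? x) (subst (y <_) (+-identityʳ x)) (subst (y <_) (sym (+-identityʳ x))))
    (sym (+-identityʳ _))
  𝟙-step x (yes _) with <-cmp y x
  ... | tri< y<x y≢x _ = trans (𝟙-yes (y <? x + 1) (<-≤-trans y<x (m≤m+n x 1)))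
    (sym (cong₂ _+_ (𝟙-yes (y <? x) y<x) (𝟙-no (x ≟ y) (y≢x ∘ sym))))
  ... | tri≈ _ refl _ = trans (𝟙-yes (y <? y + 1) (m<m+n y z<s))
    (sym (cong₂ _+_ (𝟙-no (y <? y) (n≮n y)) (𝟙-yes (y ≟ y) refl)))
  ... | tri> y≮x y≢x x<y = trans (𝟙-no (y <? x + 1) (<⇒≱ x<y ∘ ≤-pred ∘ subst (y <_) (+-comm x 1)))
    (sym (cong₂ _+_ (𝟙-no (y <? x) y≮x) (𝟙-no (x ≟ y) (y≢x ∘ sym))))

record GreedyFill (l : Fin n → ℕ) {S : Pred (Fin n) ℓ} {L : Pred (Fin n) ℓ′}
                  (S? : Decidable S) (L? : Decidable L) : Set (ℓ ⊔ ℓ′) where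
  field
    filled⊆chosen   : S ⊆ L
    chosen≤1+filled : count L? ≤ suc (count S?)
    chosen-least    : ∀ {a k} → L a → ¬ L k → l a ≤ l k

module _ {l : Fin (suc m) → ℕ} {S : Pred (Fin (suc m)) ℓ} {L : Pred (Fin (suc m)) ℓ′}
         {S? : Decidable S} {L? : Decidable L} (fill : GreedyFill l S? L?) (bal : Balanced l) where
  open GreedyFill fill

  balanced-step-at-max : ∀ {y k₀} → (∀ k → l k ≤ y) → S k₀ → l k₀ ≡ y →
    y * m + count (λ k → S? k ×-dec (l k ≟ y)) ≤ sum l + count S?
  balanced-step-at-max {zero} _ _ _ =
    ≤-trans (count-mono (λ k → S? k ×-dec (l k ≟ 0)) S? proj₁) (m≤n+m (count S?) (sum l))
  balanced-step-at-max {suc z} {k₀} l≤y Sk₀ lk₀≡y = begin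
    (m + z * m) + count SE?                        ≤⟨ +-monoˡ-≤ (count SE?) (+-monoˡ-≤ (z * m) m≤E+S∖E) ⟩
    ((count E? + count S∖E?) + z * m) + count SE?  ≡⟨ +-rearrange (count E?) (count S∖E?) (z * m) _ ⟩
    (z * m + count E?) + (count SE? + count S∖E?)  ≤⟨ +-mono-≤ level-z (≤-reflexive (sym S≡SE+S∖E)) ⟩
    sum l + count S?                               ∎
    where
    open ≤-Reasoning
    +-rearrange : ∀ a b c d → ((a + b) + c) + d ≡ (c + a) + (d + b)
    +-rearrange = solve-∀
    E? = λ k → l k ≟ suc z
    SE? = S? ∩? E?
    S∖E? = S? ∩? ∁? E?
    S≡SE+S∖E : count S? ≡ count SE? + count S∖E?
    S≡SE+S∖E = count-split S? E?
    below-max⊆L : ∀ {k} → l k ≢ suc z → L k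
    below-max⊆L {k} lk≢1+z with L? k
    ... | yes Lk = Lk
    ... | no ¬Lk = contradiction
      (≤-antisym (l≤y k) (subst (_≤ l k) lk₀≡y (chosen-least (filled⊆chosen Sk₀) ¬Lk))) lk≢1+z
    m≤E+S∖E : m ≤ count E? + count S∖E?
    m≤E+S∖E = ≤-pred (begin
      suc m                        ≡⟨ count-complement E? ⟨
      count E? + count (∁? E?)     ≤⟨ +-monoʳ-≤ (count E?) (count≤1+count-∩ S? L? (∁? E?)
                                        filled⊆chosen chosen≤1+filled below-max⊆L) ⟩
      count E? + suc (count S∖E?)  ≡⟨ +-suc _ _ ⟩
      suc (count E? + count S∖E?)  ∎)
    above-z≡E : above l z ≡ count E?
    above-z≡E = count-cong (λ k → z <? l k) E? (λ {k} z<lk → ≤-antisym (l≤y k) z<lk) (≤-reflexive ∘ sym)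
    level-z : z * m + count E? ≤ sum l
    level-z = subst (λ c → z * m + c ≤ sum l) above-z≡E
      (bal z (count-pos (λ k → z <? l k) (≤-reflexive (sym lk₀≡y))))

  balanced-step : Balanced (λ k → l k + 𝟙 (S? k))
  balanced-step y pos′ = begin
    y * m + above (λ k → l k + 𝟙 (S? k)) y  ≡⟨ cong (y * m +_) (above-+𝟙 S? l y) ⟩
    y * m + (above l y + count SE?)         ≤⟨ by-level (0 <? above l y) ⟩
    sum l + count S?                        ≡⟨ ∑-distrib-+ {suc m} l (𝟙 ∘ S?) ⟨
    sum (λ k → l k + 𝟙 (S? k))              ∎
    where
    open ≤-Reasoning
    SE? = λ k → S? k ×-dec (l k ≟ y)
    by-level : Dec (0 < above l y) → y * m + (above l y + count SE?) ≤ sum l + count S?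
    by-level (yes pos) = begin
      y * m + (above l y + count SE?)  ≡⟨ +-assoc (y * m) _ _ ⟨
      (y * m + above l y) + count SE?  ≤⟨ +-mono-≤ (bal y pos) (count-mono SE? S? proj₁) ⟩
      sum l + count S?                 ∎
    by-level (no ¬pos) = at-max (count-pos⁻ SE? (subst (0 <_) above′≡SE pos′))
      where
      above≡0 : above l y ≡ 0
      above≡0 = n≤0⇒n≡0 (≮⇒≥ ¬pos)
      above′≡SE : above (λ k → l k + 𝟙 (S? k)) y ≡ count SE?
      above′≡SE = trans (above-+𝟙 S? l y) (cong (_+ count SE?) above≡0)
      l≤y : ∀ k → l k ≤ y
      l≤y k = ≮⇒≥ λ y<lk → ¬pos (count-pos (λ k → y <? l k) y<lk)
      at-max : ∃ (λ k → S k × l k ≡ y) → y * m + (above l y + count SE?) ≤ sum l + count S?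
      at-max (k₀ , Sk₀ , lk₀≡y) = subst (λ c → y * m + (c + count SE?) ≤ sum l + count S?)
        (sym above≡0) (balanced-step-at-max l≤y Sk₀ lk₀≡y)

balanced-load≤ : {l : Fin (suc m) → ℕ} → Balanced l → ∀ {D} → sum l ≤ D * m → ∀ k → l k ≤ D
balanced-load≤ {m} {l} bal {D} sum≤ k = ≮⇒≥ λ D<lk →
  let pos = count-pos (λ i → D <? l i) D<lk in
  <⇒≱ pos (+-cancelˡ-≤ (D * m) _ 0 (≤-trans (bal D pos) (≤-trans sum≤ (≤-reflexive (sym (+-identityʳ _))))))

balanced-above≤ : {l : Fin (suc m) → ℕ} → Balanced l → ∀ {y e} → sum l ≤ y * m + e → above l y ≤ e
balanced-above≤ {m} {l} bal {y} sum≤ with 0 <? above l y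
... | yes pos = +-cancelˡ-≤ (y * m) _ _ (≤-trans (bal y pos) sum≤)
... | no ¬pos = ≤-trans (≮⇒≥ ¬pos) z≤n

-- Partial schedules

assignedTo? : (σ : Assign n m) (k : Fin m) → Decidable (λ j → lookup σ j ≡ just k)
assignedTo? σ k j = ≡-dec _≟F_ (lookup σ j) (just k)

load≡count : (σ : Assign n m) (k : Fin m) → load σ k ≡ count (assignedTo? σ k)
load≡count σ k = length-filter-tabulate (assignedTo? σ k) id

sum-load≤n : (σ : Assign n m) → sum (load σ) ≤ n
sum-load≤n {n} {m} σ = begin
  sum (load σ)                                    ≡⟨ sum-cong-≗ (load≡count σ) ⟩
  sum (λ k → sum (λ j → 𝟙 (assignedTo? σ k j)))  ≡⟨ ∑-comm {m} {n} (λ k j → 𝟙 (assignedTo? σ k j)) ⟩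
  sum (λ j → count (λ k → assignedTo? σ k j))    ≤⟨ sum≤n _ at-most-one ⟩
  n                                               ∎
  where
  open ≤-Reasoning
  at-most-one : ∀ j → count (λ k → assignedTo? σ k j) ≤ 1
  at-most-one j = count≤1 (λ k → assignedTo? σ k j) λ σj≡k σj≡k′ → just-injective (trans (sym σj≡k) σj≡k′)

load-empty : (k : Fin m) → load (emptyAssign {n} {m}) k ≡ 0
load-empty {m = m} {n = n} k = trans (load≡count ∅ k) (count-none (assignedTo? ∅ k)
  λ j σj≡k → contradiction (trans (sym (lookup-replicate j nothing)) σj≡k) λ ())
  where
  ∅ : Assign n m
  ∅ = emptyAssign

Unassigned : Assign n m → Fin n → Set
Unassigned σ j = lookup σ j ≡ nothing

load-update-fresh : (σ : Assign n m) {j : Fin n} → Unassigned σ j → ∀ k k′ →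
  load (σ [ j ]≔ just k) k′ ≡ load σ k′ + 𝟙 (k′ ≟F k)
load-update-fresh σ {j} σj≡nothing k k′ = begin
  load σ′ k′                                          ≡⟨ load≡count σ′ k′ ⟩
  count (assignedTo? σ′ k′)                           ≡⟨ +-identityʳ _ ⟨
  count (assignedTo? σ′ k′) + 0                       ≡⟨ cong (count (assignedTo? σ′ k′) +_) not-at-j ⟨
  count (assignedTo? σ′ k′) + 𝟙 (assignedTo? σ k′ j)  ≡⟨ sum-differ-at _ _ j off-j ⟩
  count (assignedTo? σ k′) + 𝟙 (assignedTo? σ′ k′ j)  ≡⟨ cong₂ _+_ (sym (load≡count σ k′)) at-j ⟩
  load σ k′ + 𝟙 (k′ ≟F k)                             ∎
  where
  open ≡-Reasoning
  σ′ = σ [ j ]≔ just k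
  not-at-j : 𝟙 (assignedTo? σ k′ j) ≡ 0
  not-at-j = 𝟙-no (assignedTo? σ k′ j) λ σj≡k′ → contradiction (trans (sym σj≡nothing) σj≡k′) λ ()
  off-j : ∀ i → i ≢ j → 𝟙 (assignedTo? σ′ k′ i) ≡ 𝟙 (assignedTo? σ k′ i)
  off-j i i≢j = cong (λ v → 𝟙 (≡-dec _≟F_ v (just k′))) (lookup∘update′ i≢j σ (just k))
  at-j : 𝟙 (assignedTo? σ′ k′ j) ≡ 𝟙 (k′ ≟F k)
  at-j = 𝟙-cong (assignedTo? σ′ k′ j) (k′ ≟F k)
    (λ σ′j≡k′ → just-injective (trans (sym σ′j≡k′) (lookup∘update j σ (just k))))
    (λ k′≡k → trans (lookup∘update j σ (just k)) (cong just (sym k′≡k)))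

load-assignPairs : (σ : Assign n m) {js : List (Fin n)} {ks : List (Fin m)} →
  Unique js → Unique ks → length ks ≤ length js → All (Unassigned σ) js →
  ∀ k → load (assignPairs (zip js ks) σ) k ≡ load σ k + 𝟙 (k ∈F? ks)
load-assignPairs σ {[]} {[]} _ _ _ _ k = sym (+-identityʳ _)
load-assignPairs σ {_ ∷ _} {[]} _ _ _ _ k = sym (+-identityʳ _)
load-assignPairs σ {j ∷ js} {k ∷ ks} (j∉js ∷ js-unique) (k∉ks ∷ ks-unique) (s≤s len≤) (σj≡nothing ∷ fresh) k′ =
  begin
  load (assignPairs (zip js ks) σ′) k′       ≡⟨ load-assignPairs σ′ js-unique ks-unique len≤ fresh′ k′ ⟩
  load σ′ k′ + 𝟙 (k′ ∈F? ks)                 ≡⟨ cong (_+ 𝟙 (k′ ∈F? ks)) (load-update-fresh σ σj≡nothing k k′) ⟩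
  (load σ k′ + 𝟙 (k′ ≟F k)) + 𝟙 (k′ ∈F? ks)  ≡⟨ +-assoc (load σ k′) _ _ ⟩
  load σ k′ + (𝟙 (k′ ≟F k) + 𝟙 (k′ ∈F? ks))  ≡⟨ cong (load σ k′ +_) (𝟙-∈-∷ k′ (All¬⇒¬Any k∉ks)) ⟨
  load σ k′ + 𝟙 (k′ ∈F? (k ∷ ks))            ∎
  where
  open ≡-Reasoning
  σ′ = σ [ j ]≔ just k
  fresh′ : All (Unassigned σ′) js
  fresh′ = All.zipWith (λ (j≢i , σi≡nothing) → trans (lookup∘update′ (j≢i ∘ sym) σ (just k)) σi≡nothing)
                       (j∉js , fresh)

lookup-assignPairs : (σ : Assign n m) (js : List (Fin n)) (ks : List (Fin m)) →
  ∀ j → lookup (assignPairs (zip js ks) σ) j ≡ lookup σ j ⊎ j ∈ js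
lookup-assignPairs σ [] ks j = inj₁ refl
lookup-assignPairs σ (j′ ∷ js) [] j = inj₁ refl
lookup-assignPairs σ (j′ ∷ js) (k ∷ ks) j
  with lookup-assignPairs (σ [ j′ ]≔ just k) js ks j | j ≟F j′
... | inj₂ j∈js | _ = inj₂ (there j∈js)
... | inj₁ _ | yes refl = inj₂ (here refl)
... | inj₁ eq | no j≢j′ = inj₁ (trans eq (lookup∘update′ j≢j′ σ (just k)))

-- One greedy step

module _ {A : Set a} (_≟_ : DecidableEquality A) where

  length-filter-≢-unique : ∀ {u} {xs : List A} → Unique xs →
    length xs ≤ suc (length (filter (λ x → ¬? (x ≟ u)) xs))
  length-filter-≢-unique {u} {[]} [] = z≤n
  length-filter-≢-unique {u} {x ∷ xs} (x∉xs ∷ unique) with x ≟ u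
  ... | yes refl =
    s≤s (≤-reflexive (cong length (sym (filter-all (λ x → ¬? (x ≟ u)) (All.map (_∘ sym) x∉xs)))))
  ... | no _ = s≤s (length-filter-≢-unique unique)

  length-filter-≢-∈ : ∀ {u} {xs : List A} → u ∈ xs →
    suc (length (filter (λ x → ¬? (x ≟ u)) xs)) ≤ length xs
  length-filter-≢-∈ {u} {xs} u∈xs =
    filter-notAll (λ x → ¬? (x ≟ u)) xs (Any.map (λ u≡x x≢u → x≢u (sym u≡x)) u∈xs)

record Adjusted (σ : Assign n m) (p : Maybe (Fin n)) (LJ : List (Fin n)) (LM : List (Fin m))
                (LJ′ : List (Fin n)) (LM′ : List (Fin m)) : Set where
  field
    jobs⊆           : ∀ {j} → j ∈ LJ′ → j ∈ LJ
    jobs-unique     : Unique LJ′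
    machines⊆       : ∀ {k} → k ∈ LM′ → k ∈ LM
    machines-unique : Unique LM′
    machines-lost≤1 : length LM ≤ suc (length LM′)
    machines≤jobs   : length LM′ ≤ length LJ′
    parent-dropped  : ∀ {j k} → j ∈ LJ′ → p ≡ just j → lookup σ j ≡ just k → ⊥

module _ (σ : Assign n m) {LJ : List (Fin n)} {LM : List (Fin m)}
         (LJ-unique : Unique LJ) (LM-unique : Unique LM) (LM≡LJ : length LM ≡ length LJ) where

  adjusted-unchanged : ∀ {p} → (∀ {j k} → p ≡ just j → lookup σ j ≡ just k → ⊥) →
    Adjusted σ p LJ LM LJ LM
  adjusted-unchanged parent-unassigned = record
    { jobs⊆ = id ; jobs-unique = LJ-unique ; machines⊆ = id ; machines-unique = LM-unique
    ; machines-lost≤1 = n≤1+n _ ; machines≤jobs = ≤-reflexive LM≡LJ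
    ; parent-dropped = λ _ → parent-unassigned }

  adjusted-parent-removed : ∀ u {LM′} → (∀ {k} → k ∈ LM′ → k ∈ LM) → Unique LM′ →
    length LM ≤ suc (length LM′) → length LM′ ≤ length LM ∸ 1 →
    Adjusted σ (just u) LJ LM (filter (λ j → ¬? (j ≟F u)) LJ) LM′
  adjusted-parent-removed u {LM′} LM′⊆LM LM′-unique lost≤1 LM′≤ = record
    { jobs⊆ = proj₁ ∘ ∈-filter⁻ (λ j → ¬? (j ≟F u))
    ; jobs-unique = Unique.filter⁺ (λ j → ¬? (j ≟F u)) LJ-unique
    ; machines⊆ = LM′⊆LM
    ; machines-unique = LM′-unique
    ; machines-lost≤1 = lost≤1
    ; machines≤jobs = begin
        length LM′                              ≤⟨ LM′≤ ⟩
        length LM ∸ 1                           ≡⟨ cong (_∸ 1) LM≡LJ ⟩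
        length LJ ∸ 1                           ≤⟨ ∸-monoˡ-≤ 1 (length-filter-≢-unique _≟F_ LJ-unique) ⟩
        length (filter (λ j → ¬? (j ≟F u)) LJ)  ∎
    ; parent-dropped = λ j∈LJ′ → λ { refl _ → proj₂ (∈-filter⁻ (λ j → ¬? (j ≟F u)) {xs = LJ} j∈LJ′) refl }
    }
    where open ≤-Reasoning

adjust-spec : (σ : Assign n m) (p : Maybe (Fin n)) {LJ : List (Fin n)} {LM : List (Fin m)} →
  Unique LJ → Unique LM → length LM ≡ length LJ →
  Adjusted σ p LJ LM (proj₁ (adjust σ p LJ LM)) (proj₂ (adjust σ p LJ LM))
adjust-spec σ nothing LJ-unique LM-unique LM≡LJ = adjusted-unchanged σ LJ-unique LM-unique LM≡LJ λ ()
adjust-spec σ (just u) {LJ} {LM} LJ-unique LM-unique LM≡LJ with lookup σ u in σu≡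
... | nothing = adjusted-unchanged σ LJ-unique LM-unique LM≡LJ
      λ { refl σu≡k → contradiction (trans (sym σu≡) σu≡k) λ () }
... | just M′ with M′ ∈F? LM
...   | yes M′∈LM = adjusted-parent-removed σ LJ-unique LM-unique LM≡LJ u
        (proj₁ ∘ ∈-filter⁻ (λ k → ¬? (k ≟F M′)))
        (Unique.filter⁺ (λ k → ¬? (k ≟F M′)) LM-unique)
        (length-filter-≢-unique _≟F_ LM-unique)
        (∸-monoˡ-≤ 1 (length-filter-≢-∈ _≟F_ M′∈LM))
...   | no _ = adjusted-parent-removed σ LJ-unique LM-unique LM≡LJ u
        (Any-resp-⊆ (take-⊆ (length LM ∸ 1) LM))
        (Unique.take⁺ (length LM ∸ 1) LM-unique)
        (≤-trans (m≤n+m∸n (length LM) 1) (s≤s (≤-reflexive (sym length-init))))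
        (≤-reflexive length-init)
  where
  length-init : length (take (length LM ∸ 1) LM) ≡ length LM ∸ 1
  length-init = trans (length-take (length LM ∸ 1) LM) (m≤n⇒m⊓n≡m (m∸n≤m (length LM) 1))

OnlyParentAssigned : Assign n m → Subset n × Maybe (Fin n) → Set
OnlyParentAssigned σ (B , p) = ∀ {j k} → j ∈ₛ B → lookup σ j ≡ just k → p ≡ just j

module _ {σ σ′ : Assign n m} {B p} (st : Step σ B p σ′) where
  open Step st
  private
    LJ′ = proj₁ (adjust σ p LJ LM)
    LM≡LJ : length LM ≡ length LJ
    LM≡LJ = trans LM-size (sym (length≡∣∣ LJ-unique LJ-jobs))
  open Adjusted (adjust-spec σ p LJ-unique LM-unique LM≡LJ)

  filled : List (Fin m)
  filled = proj₂ (adjust σ p LJ LM)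

  step-frame : ∀ j → lookup σ′ j ≡ lookup σ j ⊎ j ∈ₛ B
  step-frame j = Sum.map₂ (λ j∈LJ′ → Equivalence.to (LJ-jobs j) (jobs⊆ j∈LJ′))
    (subst (λ τ → lookup τ j ≡ lookup σ j ⊎ j ∈ LJ′) (sym result) (lookup-assignPairs σ LJ′ filled j))

  step-load : OnlyParentAssigned σ (B , p) → ∀ k → load σ k + 𝟙 (k ∈F? filled) ≡ load σ′ k
  step-load only-parent k = sym (trans (cong (λ τ → load τ k) result)
    (load-assignPairs σ jobs-unique machines-unique machines≤jobs (All.tabulate unassigned) k))
    where
    unassigned : ∀ {j} → j ∈ LJ′ → Unassigned σ j
    unassigned {j} j∈LJ′ with lookup σ j in σj≡
    ... | nothing = refl
    ... | just k =
      ⊥-elim (parent-dropped j∈LJ′ (only-parent (Equivalence.to (LJ-jobs j) (jobs⊆ j∈LJ′)) σj≡) σj≡)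

  step-fill : GreedyFill (load σ) (_∈F? filled) (_∈F? LM)
  step-fill = record
    { filled⊆chosen = machines⊆
    ; chosen≤1+filled = subst₂ (λ c c′ → c ≤ suc c′)
        (sym (count-∈-unique LM-unique)) (sym (count-∈-unique machines-unique)) machines-lost≤1
    ; chosen-least = λ a∈LM k∉LM → All.lookup (LM-smallest _ k∉LM) a∈LM
    }

step-balanced : {σ σ′ : Assign n (suc m)} {B : Subset n} {p : Maybe (Fin n)} → Step σ B p σ′ →
  OnlyParentAssigned σ (B , p) → Balanced (load σ) → Balanced (load σ′)
step-balanced st only-parent bal =
  Balanced-resp-≗ (step-load st only-parent) (balanced-step (step-fill st) bal)

MeetsAtParent : Subset n × Maybe (Fin n) → Subset n × Maybe (Fin n) → Set
MeetsAtParent (B′ , _) (B , p) = ∀ {j} → j ∈ₛ B′ → j ∈ₛ B → p ≡ just j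

run-balanced : {σ σ′ : Assign n (suc m)} {bs : List (Subset n × Maybe (Fin n))} → Run σ bs σ′ →
  AllPairs MeetsAtParent bs → All (OnlyParentAssigned σ) bs → Balanced (load σ) → Balanced (load σ′)
run-balanced done _ _ bal = bal
run-balanced {σ = σ} (step {σ₁ = σ₁} {B = B} {p = p} st run) (meets ∷ pairs) (only-parent ∷ rest) bal =
  run-balanced run pairs (All.zipWith still-only-parent (meets , rest)) (step-balanced st only-parent bal)
  where
  still-only-parent : ∀ {e} → MeetsAtParent (B , p) e × OnlyParentAssigned σ e → OnlyParentAssigned σ₁ e
  still-only-parent (meets-e , only-parent-e) {j} j∈e σ₁j≡k with step-frame st j
  ... | inj₁ σ₁j≡σj = only-parent-e j∈e (trans (sym σ₁j≡σj) σ₁j≡k)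
  ... | inj₂ j∈B = meets-e j∈B j∈e

-- Pre-order of the block-cut forest

data Before {A : Set a} (x y : A) : List A → Set a where
  here  : ∀ {xs} → y ∈ xs → Before x y (x ∷ xs)
  there : ∀ {z xs} → Before x y xs → Before x y (z ∷ xs)

module _ {A : Set a} {x y : A} where

  Before-∈ˡ : ∀ {xs} → Before x y xs → x ∈ xs
  Before-∈ˡ (here _) = here refl
  Before-∈ˡ (there b) = there (Before-∈ˡ b)

  Before-∈ʳ : ∀ {xs} → Before x y xs → y ∈ xs
  Before-∈ʳ (here y∈xs) = there y∈xs
  Before-∈ʳ (there b) = there (Before-∈ʳ b)

  Before-tail : ∀ {z xs} → Before x y (z ∷ xs) → y ∈ xs
  Before-tail (here y∈xs) = y∈xs
  Before-tail (there b) = Before-∈ʳ b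

  Before-++ʳ : ∀ {xs} ys → Before x y xs → Before x y (xs ++ ys)
  Before-++ʳ ys (here y∈xs) = here (∈-++⁺ˡ y∈xs)
  Before-++ʳ ys (there b) = there (Before-++ʳ ys b)

  Before-++ˡ : ∀ xs {ys} → Before x y ys → Before x y (xs ++ ys)
  Before-++ˡ [] b = b
  Before-++ˡ (_ ∷ xs) b = there (Before-++ˡ xs b)

Before-irrefl : {A : Set a} {x : A} {xs : List A} → Unique xs → ¬ Before x x xs
Before-irrefl (x∉xs ∷ _) (here x∈xs) = All¬⇒¬Any x∉xs x∈xs
Before-irrefl (_ ∷ unique) (there b) = Before-irrefl unique b

Before-trans : {A : Set a} {x y z : A} {xs : List A} → Unique xs →
  Before x y xs → Before y z xs → Before x z xs
Before-trans (_ ∷ _) (here _) (here z∈xs) = here z∈xs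
Before-trans (_ ∷ _) (here _) (there b) = here (Before-∈ʳ b)
Before-trans (y∉xs ∷ _) (there b) (here _) = contradiction (Before-∈ʳ b) (All¬⇒¬Any y∉xs)
Before-trans (_ ∷ unique) (there b) (there b′) = there (Before-trans unique b b′)

Unique-++⁻ : {A : Set a} (xs : List A) {ys : List A} → Unique (xs ++ ys) →
  Unique xs × Unique ys × (∀ {x} → x ∈ xs → x ∉ ys)
Unique-++⁻ [] unique = [] , unique , λ ()
Unique-++⁻ (x ∷ xs) (x∉ ∷ unique) with Unique-++⁻ xs unique
... | xs-unique , ys-unique , disjoint = ++⁻ˡ xs x∉ ∷ xs-unique , ys-unique , disjoint′
  where
  disjoint′ : ∀ {z} → z ∈ x ∷ xs → z ∉ _
  disjoint′ (here refl) = All¬⇒¬Any (++⁻ʳ xs x∉)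
  disjoint′ (there z∈xs) = disjoint z∈xs

AllPairs-map-∈ : {A : Set a} {R S : A → A → Set ℓ} {xs : List A} →
  (∀ {x y} → y ∈ xs → R x y → S x y) → AllPairs R xs → AllPairs S xs
AllPairs-map-∈ f [] = []
AllPairs-map-∈ f (Rx ∷ Rxs) =
  All.tabulate (λ y∈ → f (there y∈) (All.lookup Rx y∈)) ∷ AllPairs-map-∈ (f ∘ there) Rxs

module _ {A : Set a} {B : Set} {f : A → B} where

  Sublist-map-∈ : ∀ {x xs ys} → Sublist (λ x y → f x ≡ y) xs ys → x ∈ xs → f x ∈ ys
  Sublist-map-∈ = Sublist.lookup λ fx≡y x≡x′ → trans (cong f x≡x′) fx≡y

  Sublist-map-Before : ∀ {xs ys} → Sublist (λ x y → f x ≡ y) xs ys →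
    AllPairs (λ x x′ → Before (f x) (f x′) ys) xs
  Sublist-map-Before [] = []
  Sublist-map-Before (y ∷ʳ s) = AllPairs.map there (Sublist-map-Before s)
  Sublist-map-Before (refl ∷ s) =
    All.tabulate (here ∘ Sublist-map-∈ s) ∷ AllPairs.map there (Sublist-map-Before s)

module _ {A : Set} where

  RootIn : A → Forest A → Set
  RootIn b = Any (λ t → label t ≡ b)

  root∈preorder : ∀ {b} ts → RootIn b ts → b ∈ preorderF ts
  root∈preorder (node c us ∷ ts) (here refl) = here refl
  root∈preorder (t ∷ ts) (there r) = ∈-++⁺ʳ (preorder t) (root∈preorder ts r)

  ∈-childEdges⁻ : ∀ {a b c} us → (a , b) ∈ childEdges c us → a ≡ c × RootIn b us
  ∈-childEdges⁻ (t ∷ us) (here refl) = refl , here refl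
  ∈-childEdges⁻ (t ∷ us) (there e) = Product.map₂ there (∈-childEdges⁻ us e)

  ∈-childEdges⁺ : ∀ {b c} us → RootIn b us → (c , b) ∈ childEdges c us
  ∈-childEdges⁺ (t ∷ us) (here refl) = here refl
  ∈-childEdges⁺ (t ∷ us) (there r) = there (∈-childEdges⁺ us r)

  mutual
    edge-Before : ∀ {a b} t → (a , b) ∈ edges t → Before a b (preorder t)
    edge-Before (node c us) e with ∈-++⁻ (childEdges c us) e
    ... | inj₁ e′ with ∈-childEdges⁻ us e′
    ...   | refl , r = here (root∈preorder us r)
    edge-Before (node c us) e | inj₂ e′ = there (edgeF-Before us e′)

    edgeF-Before : ∀ {a b} ts → (a , b) ∈ edgesF ts → Before a b (preorderF ts)
    edgeF-Before (t ∷ ts) e with ∈-++⁻ (edges t) e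
    ... | inj₁ e′ = Before-++ʳ (preorderF ts) (edge-Before t e′)
    ... | inj₂ e′ = Before-++ˡ (preorder t) (edgeF-Before ts e′)

  root-parentless : ∀ {a b} ts → Unique (preorderF ts) → RootIn b ts → ¬ (a , b) ∈ edgesF ts
  root-parentless (t@(node c us) ∷ ts) unique r e
    with Unique-++⁻ (preorder t) unique | r | ∈-++⁻ (edges t) e
  ... | (c∉us ∷ _) , _ , _ | here refl | inj₁ e′ = All¬⇒¬Any c∉us (Before-tail (edge-Before t e′))
  ... | _ , _ , disjoint | here refl | inj₂ e′ = disjoint (here refl) (Before-∈ʳ (edgeF-Before ts e′))
  ... | _ , _ , disjoint | there r′ | inj₁ e′ = disjoint (Before-∈ʳ (edge-Before t e′)) (root∈preorder ts r′)
  ... | _ , ts-unique , _ | there r′ | inj₂ e′ = root-parentless ts ts-unique r′ e′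

  mutual
    parent-unique : ∀ {a a′ b} t → Unique (preorder t) →
      (a , b) ∈ edges t → (a′ , b) ∈ edges t → a ≡ a′
    parent-unique (node c us) (_ ∷ unique) e e′
      with ∈-++⁻ (childEdges c us) e | ∈-++⁻ (childEdges c us) e′
    ... | inj₁ x | inj₁ y = trans (proj₁ (∈-childEdges⁻ us x)) (sym (proj₁ (∈-childEdges⁻ us y)))
    ... | inj₂ x | inj₂ y = parentF-unique us unique x y
    ... | inj₁ x | inj₂ y = ⊥-elim (root-parentless us unique (proj₂ (∈-childEdges⁻ us x)) y)
    ... | inj₂ x | inj₁ y = ⊥-elim (root-parentless us unique (proj₂ (∈-childEdges⁻ us y)) x)

    parentF-unique : ∀ {a a′ b} ts → Unique (preorderF ts) →
      (a , b) ∈ edgesF ts → (a′ , b) ∈ edgesF ts → a ≡ a′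
    parentF-unique (t ∷ ts) unique e e′
      with Unique-++⁻ (preorder t) unique | ∈-++⁻ (edges t) e | ∈-++⁻ (edges t) e′
    ... | t-unique , _ , _ | inj₁ x | inj₁ y = parent-unique t t-unique x y
    ... | _ , ts-unique , _ | inj₂ x | inj₂ y = parentF-unique ts ts-unique x y
    ... | _ , _ , disjoint | inj₁ x | inj₂ y =
      ⊥-elim (disjoint (Before-∈ʳ (edge-Before t x)) (Before-∈ʳ (edgeF-Before ts y)))
    ... | _ , _ , disjoint | inj₂ x | inj₁ y =
      ⊥-elim (disjoint (Before-∈ʳ (edge-Before t y)) (Before-∈ʳ (edgeF-Before ts x)))

cutParent : Node n → Maybe (Fin n)
cutParent (blkN _) = nothing
cutParent (cutN v) = just v

BlockOrigin : Maybe (Fin n) → Forest (Node n) → Subset n → Maybe (Fin n) → Set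
BlockOrigin q ts B p =
  (p ≡ q × RootIn (blkN B) ts) ⊎ (∃ λ a → (a , blkN B) ∈ edgesF ts × p ≡ cutParent a)

child-origin : {B : Subset n} {p : Maybe (Fin n)} (c : Node n) (us : Forest (Node n)) →
  BlockOrigin (cutParent c) us B p → ∃ λ a → (a , blkN B) ∈ edges (node c us) × p ≡ cutParent a
child-origin c us (inj₁ (p≡ , root)) = c , ∈-++⁺ˡ (∈-childEdges⁺ us root) , p≡
child-origin c us (inj₂ (a , e , p≡)) = a , ∈-++⁺ʳ (childEdges c us) e , p≡

mutual
  blockSeq-origin : {B : Subset n} {p : Maybe (Fin n)} (q : Maybe (Fin n)) (t : Tree (Node n)) →
    (B , p) ∈ blockSeq q t →
    (p ≡ q × label t ≡ blkN B) ⊎ (∃ λ a → (a , blkN B) ∈ edges t × p ≡ cutParent a)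
  blockSeq-origin q (node (blkN B) us) (here refl) = inj₁ (refl , refl)
  blockSeq-origin q (node (blkN B) us) (there b∈) =
    inj₂ (child-origin (blkN B) us (blockSeqF-origin nothing us b∈))
  blockSeq-origin q (node (cutN v) us) b∈ =
    inj₂ (child-origin (cutN v) us (blockSeqF-origin (just v) us b∈))

  blockSeqF-origin : {B : Subset n} {p : Maybe (Fin n)} (q : Maybe (Fin n)) (ts : Forest (Node n)) →
    (B , p) ∈ blockSeqF q ts → BlockOrigin q ts B p
  blockSeqF-origin q (t ∷ ts) b∈ with ∈-++⁻ (blockSeq q t) b∈
  ... | inj₁ b∈t with blockSeq-origin q t b∈t
  ...   | inj₁ (p≡q , root) = inj₁ (p≡q , here root)
  ...   | inj₂ (a , e , p≡) = inj₂ (a , ∈-++⁺ˡ e , p≡)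
  blockSeqF-origin q (t ∷ ts) b∈ | inj₂ b∈ts with blockSeqF-origin q ts b∈ts
  ...   | inj₁ (p≡q , root) = inj₁ (p≡q , there root)
  ...   | inj₂ (a , e , p≡) = inj₂ (a , ∈-++⁺ʳ (edges t) e , p≡)

blockSeq-parent : {B : Subset n} {p : Maybe (Fin n)} {j : Fin n} (F : Forest (Node n)) →
  Unique (preorderF F) → (B , p) ∈ blockSeqF nothing F → (cutN j , blkN B) ∈ edgesF F → p ≡ just j
blockSeq-parent F unique b∈ j→B with blockSeqF-origin nothing F b∈
... | inj₁ (_ , root) = ⊥-elim (root-parentless F unique root j→B)
... | inj₂ (a , a→B , p≡) with parentF-unique F unique a→B j→B
...   | refl = p≡

blockNode : Subset n × Maybe (Fin n) → Node n
blockNode = blkN ∘ proj₁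

mutual
  blockSeq-sublist : (q : Maybe (Fin n)) (t : Tree (Node n)) →
    Sublist (λ e x → blockNode e ≡ x) (blockSeq q t) (preorder t)
  blockSeq-sublist q (node (blkN B) ts) = refl ∷ blockSeqF-sublist nothing ts
  blockSeq-sublist q (node (cutN v) ts) = cutN v ∷ʳ blockSeqF-sublist (just v) ts

  blockSeqF-sublist : (q : Maybe (Fin n)) (ts : Forest (Node n)) →
    Sublist (λ e x → blockNode e ≡ x) (blockSeqF q ts) (preorderF ts)
  blockSeqF-sublist q [] = []
  blockSeqF-sublist q (t ∷ ts) = Sublist.++⁺ (blockSeq-sublist q t) (blockSeqF-sublist q ts)

blockSeq-meets-at-parent : {G : Graph n} {F : Forest (Node n)} → IsBlockCutForest G F →
  AllPairs MeetsAtParent (blockSeqF nothing F)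
blockSeq-meets-at-parent {n} {G} {F} bcf =
  AllPairs-map-∈ (λ {e′} {e} → meets {e′} {e}) (Sublist-map-Before (blockSeqF-sublist nothing F))
  where
  open IsBlockCutForest bcf
  meets : {e′ e : Subset n × Maybe (Fin n)} → e ∈ blockSeqF nothing F →
    Before (blockNode e′) (blockNode e) (preorderF F) → MeetsAtParent e′ e
  meets {B′ , _} {B , p} e∈ B′<B {j} j∈B′ j∈B = from-edge (edgesComplete B j B-block j-cut j∈B)
    where
    B′-block : IsBlock G B′
    B′-block = Equivalence.to (blockNodes B′) (Before-∈ˡ B′<B)
    B-block : IsBlock G B
    B-block = Equivalence.to (blockNodes B) (Before-∈ʳ B′<B)
    B′≢B : B′ ≢ B
    B′≢B refl = Before-irrefl nodesUnique B′<B
    j-cut : IsCutVertex G j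
    j-cut = B′ , B , B′-block , B-block , B′≢B , j∈B′ , j∈B
    from-edge : (blkN B , cutN j) ∈ edgesF F ⊎ (cutN j , blkN B) ∈ edgesF F → p ≡ just j
    from-edge (inj₂ j→B) = blockSeq-parent F nodesUnique e∈ j→B
    from-edge (inj₁ B→j) with edgesComplete B′ j B′-block j-cut j∈B′
    ... | inj₁ B′→j with parentF-unique F nodesUnique B→j B′→j
    ...   | refl = contradiction refl B′≢B
    from-edge (inj₁ B→j) | inj₂ j→B′ =
      ⊥-elim (Before-irrefl nodesUnique (Before-trans nodesUnique B′<B
        (Before-trans nodesUnique (edgeF-Before F B→j) (edgeF-Before F j→B′))))

greedy-balanced : {G : Graph n} {F : Forest (Node n)} {σ : Assign n (suc m)} →
  IsBlockCutForest G F → GreedyOutput G F σ → Balanced (load σ)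
greedy-balanced {n} {m} bcf run =
  run-balanced run (blockSeq-meets-at-parent bcf) (All.tabulate λ _ → nothing-assigned)
    (balanced-zero (load-empty {n = n}))
  where
  nothing-assigned : ∀ {e} → OnlyParentAssigned (emptyAssign {n} {suc m}) e
  nothing-assigned {j = j} _ σj≡k = contradiction (trans (sym (lookup-replicate j nothing)) σj≡k) λ ()

-- The bounds

[q*n+r]/n≡q : ∀ q {n r} .{{_ : NonZero n}} → r < n → (q * n + r) / n ≡ q
[q*n+r]/n≡q q {n} {r} r<n = begin
  (q * n + r) / n    ≡⟨ +-distrib-/-∣ˡ r (n∣m*n q) ⟩
  q * n / n + r / n  ≡⟨ cong₂ _+_ (m*n/n≡m q n) (m<n⇒m/n≡0 r<n) ⟩
  q + 0              ≡⟨ +-identityʳ q ⟩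
  q                  ∎
  where open ≡-Reasoning

ceilDiv-+ : ∀ q {k s} → 0 < s → s ≤ suc k → ceilDiv (q * suc k + s) (suc k) ≡ suc q
ceilDiv-+ q {k} {suc s} _ s<1+k = trans (cong (_/ suc k) (rearrange q k s)) ([q*n+r]/n≡q (suc q) s<1+k)
  where
  rearrange : ∀ q k s → q * suc k + suc s + k ≡ suc q * suc k + s
  rearrange = solve-∀

countBelow-+-above : (σ : Assign n (suc m)) (y : ℕ) → countBelow σ (suc y) + above (load σ) y ≡ suc m
countBelow-+-above {m = m} σ y = begin
  countBelow σ (suc y) + above (load σ) y  ≡⟨ cong (_+ above (load σ) y) below≡∁above ⟩
  count (∁? A?) + above (load σ) y         ≡⟨ +-comm (count (∁? A?)) _ ⟩
  above (load σ) y + count (∁? A?)         ≡⟨ count-complement A? ⟩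
  suc m                                    ∎
  where
  open ≡-Reasoning
  A? = λ k → y <? load σ k
  below≡∁above : countBelow σ (suc y) ≡ count (∁? A?)
  below≡∁above = trans (length-filter-tabulate (λ k → load σ k <? suc y) id)
    (count-cong (λ k → load σ k <? suc y) (∁? A?) <⇒≱ (s≤s ∘ ≮⇒≥))

balanced-bounds : ∀ {k s} (σ : Assign n (suc (suc k))) (q : ℕ) → Balanced (load σ) →
  n ≡ q * suc k + s → 0 < s → s ≤ suc k →
  (∀ i → load σ i ≤ ceilDiv n (suc k)) × (suc (suc k) ∸ s ≤ countBelow σ (ceilDiv n (suc k)))
balanced-bounds {k = k} {s} σ q bal refl 0<s s≤1+k =
  subst (λ c → ∀ i → load σ i ≤ c) (sym ceil≡) load-bound ,
  subst (λ c → suc (suc k) ∸ s ≤ countBelow σ c) (sym ceil≡) below-bound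
  where
  ceil≡ : ceilDiv (q * suc k + s) (suc k) ≡ suc q
  ceil≡ = ceilDiv-+ q 0<s s≤1+k
  load-bound : ∀ i → load σ i ≤ suc q
  load-bound = balanced-load≤ {l = load σ} bal
    (≤-trans (sum-load≤n σ) (≤-trans (+-monoʳ-≤ (q * suc k) s≤1+k) (≤-reflexive (+-comm _ (suc k)))))
  below-bound : suc (suc k) ∸ s ≤ countBelow σ (suc q)
  below-bound = begin
    suc (suc k) ∸ s                       ≤⟨ ∸-monoʳ-≤ (suc (suc k)) above≤s ⟩
    suc (suc k) ∸ high                    ≡⟨ cong (_∸ high) (countBelow-+-above σ q) ⟨
    (countBelow σ (suc q) + high) ∸ high  ≡⟨ m+n∸n≡m (countBelow σ (suc q)) high ⟩
    countBelow σ (suc q)                  ∎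
    where
    open ≤-Reasoning
    high : ℕ
    high = above (load σ) q
    above≤s : high ≤ s
    above≤s = balanced-above≤ {l = load σ} bal (sum-load≤n σ)

lemma13 : (n m : ℕ) → 1 ≤ n → 2 ≤ m →
    (G : Graph n) → IsBlockGraph G →
    (∀ B → IsBlock G B → ∣ B ∣ ≤ m) →
    (d r : ℕ) → n ≡ d * (m ∸ 1) + r → r ≤ m ∸ 2 →
    (F : Forest (Node n)) → IsBlockCutForest G F →
    (σ : Assign n m) → GreedyOutput G F σ →
    (∀ (k : Fin m) → load σ k ≤ ceilDiv n (m ∸ 1)) ×
    (r ≡ 0 → 1 ≤ countBelow σ (ceilDiv n (m ∸ 1))) ×
    (¬ (r ≡ 0) → m ∸ r ≤ countBelow σ (ceilDiv n (m ∸ 1)))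
lemma13 _ zero _ () _ _ _ _ _ _ _ _ _ _ _
lemma13 _ (suc zero) _ (s≤s ()) _ _ _ _ _ _ _ _ _ _ _
lemma13 n (suc (suc k)) 1≤n _ _ _ _ zero zero n≡0 _ _ _ _ _ = contradiction (subst (1 ≤_) n≡0 1≤n) λ ()
lemma13 n (suc (suc k)) _ _ _ _ _ (suc q) zero n≡ _ F bcf σ run
  with balanced-bounds σ q (greedy-balanced bcf run) (trans n≡ (trans (+-identityʳ _) (+-comm (suc k) _)))
         z<s ≤-refl
... | load≤ , one-below =
  load≤ , (λ _ → subst (_≤ countBelow σ (ceilDiv n (suc k))) (m+n∸n≡m 1 (suc k)) one-below) ,
  (λ r≢0 → contradiction refl r≢0)
lemma13 n (suc (suc k)) _ _ _ _ _ q (suc r) n≡ r≤k F bcf σ run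
  with balanced-bounds σ q (greedy-balanced bcf run) n≡ z<s (m≤n⇒m≤1+n r≤k)
... | load≤ , below = load≤ , (λ ()) , (λ _ → below)
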